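{- Let $k$ be a positive integer and $\lambda=(\lambda_1,\dots,\lambda_r)$ an integer partition of $k$. If $\mu$ is the partition obtained from $\lambda$ by replacing two parts $\lambda_i,\lambda_j$ ($i\neq j$), not both equal to $1$, by their sum $\lambda_i+\lambda_j$ (and sorting), then $\mu$ is covered by $\lambda$ in the partial order $\preceq$, i.e. $\mu\prec\lambda$ and there is no $\nu$ with $\mu\prec\nu\prec\lambda$.
   Context: A set partition of a finite set is a set of nonempty pairwise disjoint blocks whose union is the set; its type is the integer partition of sorted block sizes. For set partitions of $[k]=\{1,\dots,k\}$, $\pi\vee\tau$ denotes their join in refinement order (finest set partition coarser than both). For integer partitions $\mu,\lambda$ of $k$, $\mu\preceq\lambda$ means there exist $\ell\ge0$ and set partitions $\pi_0,\dots,\pi_\ell$ of $[k]$ of type $\lambda$ with $\pi_0\vee\cdots\vee\pi_\ell$ of type $\mu$; this is a partial order, and $\mu\prec\lambda$ means $\mu\preceq\lambda$ and $\mu\neq\lambda$. -}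

module Defs where

open import Data.Nat using (ℕ; zero; suc; _+_; _≥_; _<_; _≤_)
open import Data.Fin using (Fin)
open import Data.Fin.Properties using (_≟_)
open import Data.List using (List; []; _∷_; length; map; filter; lookup; allFin)
open import Data.Nat.ListAction using (sum)
open import Data.List.Relation.Unary.All using (All)
open import Data.List.Relation.Unary.Linked using (Linked)
open import Data.List.Relation.Binary.Permutation.Propositional using (_↭_)
open import Data.Product using (Σ; _×_; ∃; ∃-syntax)
open import Relation.Binary.PropositionalEquality using (_≡_; _≢_)
open import Relation.Nullary using (¬_)
open import Relation.Nullary.Decidable using (¬?; _×-dec_)

IsIntPartition : ℕ → List ℕ → Set
IsIntPartition k λs = All (λ p → 0 < p) λs × Linked _≥_ λs × sum λs ≡ k

-- A set partition of [k] = Fin k, given by a block labelling: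
-- i and j lie in the same block iff they receive the same label.
-- (At most k blocks, so labels in Fin k suffice.)
SetPartition : ℕ → Set
SetPartition k = Fin k → Fin k

_≤ʳ_ : {k : ℕ} → SetPartition k → SetPartition k → Set
π ≤ʳ σ = ∀ i j → π i ≡ π j → σ i ≡ σ j

blockSize : {k : ℕ} → SetPartition k → Fin k → ℕ
blockSize {k} π c = length (filter (λ i → π i ≟ c) (allFin k))

blockSizes : {k : ℕ} → SetPartition k → List ℕ
blockSizes {k} π = filter (λ n → ¬? (n Data.Nat.≟ 0)) (map (blockSize π) (allFin k))
  where import Data.Nat

-- π has type λ: the sorted list of block sizes is λ (for λ a sorted list,
-- equivalent to: the block sizes form λ as a multiset).
HasType : {k : ℕ} → SetPartition k → List ℕ → Set
HasType π λs = blockSizes π ↭ λs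

IsJoin : {k ℓ : ℕ} → (Fin ℓ → SetPartition k) → SetPartition k → Set
IsJoin πs σ = (∀ t → πs t ≤ʳ σ) × (∀ τ → (∀ t → πs t ≤ʳ τ) → σ ≤ʳ τ)

_⪯[_]_ : List ℕ → ℕ → List ℕ → Set
μ ⪯[ k ] λs = ∃[ ℓ ] Σ (Fin (suc ℓ) → SetPartition k) λ πs →
  (∀ t → HasType (πs t) λs) × (∃[ σ ] IsJoin πs σ × HasType σ μ)

_≺[_]_ : List ℕ → ℕ → List ℕ → Set
μ ≺[ k ] λs = μ ⪯[ k ] λs × μ ≢ λs

removeTwo : (λs : List ℕ) → Fin (length λs) → Fin (length λs) → List ℕ
removeTwo λs i j =
  map (lookup λs) (filter (λ m → ¬? (m ≟ i) ×-dec ¬? (m ≟ j)) (allFin (length λs)))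

module Submission where

-- The type μ arises as the join of two set partitions of type λ that differ by swapping one
-- element of the block of size λᵢ with one element of the block of size λⱼ: a third element
-- lying in one of the two blocks in both partitions links them, which is where "not both
-- equal to 1" is needed.  For the covering, give each element of [k] the weight
-- k! / |block containing it|.  The weights add up to k! times the number of blocks, and
-- passing to a coarser partition can only lower each weight; so a coarsening has no more blocks,
-- and it has as many only if no block size changes, i.e. only if the type is the same.
-- Hence μ ≺ ν forces ν to have strictly more parts than μ, and μ has exactly one part
-- fewer than λ.

open import Defs

open import Algebra.Properties.CommutativeSemigroup using (interchange)
open import Data.Bool using (Bool; true; false)
open import Data.Empty using (⊥-elim)
open import Data.Fin using (Fin; zero; suc; toℕ)
import Data.Fin.Properties as Fin
open import Data.Fin.Properties using (toℕ-fromℕ<; toℕ-injective)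
open import Data.List using (List; []; _∷_; _++_; length; map; filter; allFin; tabulate; lookup; replicate)
open import Data.List.Properties
  using ( map-tabulate; map-cong; map-∘; tabulate-cong; tabulate-lookup; length-++; length-replicate
        ; length-filter; length-tabulate; filter-accept; filter-reject; filter-all; filter-none
        ; filter-some; filter-≐; filter-++; ++-identityʳ)
open import Data.List.Membership.Propositional using (_∈_)
open import Data.List.Membership.Propositional.Properties using (∈-allFin; ∈-filter⁺; ∈-map⁺)
open import Data.List.Relation.Unary.All as All using (All; []; _∷_)
open import Data.List.Relation.Unary.All.Properties using (all-filter; replicate⁺)
open import Data.List.Relation.Unary.AllPairs using (_∷_)
open import Data.List.Relation.Unary.Any as Any using (Any; here; there)
open import Data.List.Relation.Unary.Linked as Linked using (Linked)
open import Data.List.Relation.Unary.Linked.Properties using (Linked⇒All)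
open import Data.List.Relation.Unary.Unique.Propositional using (Unique)
import Data.List.Relation.Unary.Unique.Propositional.Properties as Unique
open import Data.List.Relation.Binary.Permutation.Propositional
  using (_↭_; ↭-refl; ↭-sym; ↭-trans; ↭-prep; ↭-swap; ↭-reflexive; module PermutationReasoning)
open import Data.List.Relation.Binary.Permutation.Propositional.Properties
  using (↭-length; filter-↭; map⁺; All-resp-↭)
open import Data.List.Relation.Binary.Sublist.Propositional using (⊆-refl)
import Data.List.Relation.Binary.Sublist.Propositional.Properties as Sublist
open import Data.Nat
  using (ℕ; zero; suc; _+_; _*_; _∸_; _≤_; _<_; _≥_; z≤n; s≤s; _≟_; _<?_; _!; _/_; NonZero; ≢-nonZero; ≢-nonZero⁻¹)
open import Data.Nat.DivMod using (m*[n/m]≡n; /-monoʳ-≤; _mod_; m<n⇒m%n≡m)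
open import Data.Nat.Divisibility using (∣-trans; m∣m*n; m≤n⇒m!∣n!)
open import Data.Nat.ListAction using (sum)
open import Data.Nat.ListAction.Properties using (sum-↭)
open import Data.Nat.Properties
  using ( ≤-refl; ≤-reflexive; ≤-trans; ≤-antisym; ≤-pred; <-irrefl; ≮⇒≥; <⇒≢; <⇒≱; ≤∧≢⇒<; m≤n⇒m<n∨m≡n
        ; n≤1+n; n<1+n; m<n⇒m<1+n; m≤n+m; 1+n≢n; m+1+n≢m; +-suc; +-assoc; +-comm; +-identityʳ
        ; +-cancelˡ-≡; +-mono-≤; +-mono-<-≤; *-zeroʳ; *-identityʳ; *-distribˡ-+; *-distribʳ-+
        ; *-cancelʳ-≡; *-cancelˡ-≡; *-cancelˡ-≤; _!≢0; +-commutativeSemigroup; module ≤-Reasoning)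
open import Data.Product using (Σ; _×_; _,_; proj₂)
open import Data.Sum using (_⊎_; inj₁; inj₂)
open import Function using (_∘_)
open import Relation.Binary using (DecidableEquality)
open import Relation.Binary.PropositionalEquality
  using (_≡_; _≢_; ≢-sym; refl; sym; trans; subst; subst₂; cong; cong₂; module ≡-Reasoning)
open import Relation.Nullary using (¬_; yes; no; does; ¬?; _×-dec_)
open import Relation.Nullary.Decidable using (dec-false)
open import Relation.Unary using (Pred; Decidable; _≐_)

𝟙 : Bool → ℕ
𝟙 true = 1
𝟙 false = 0

module _ {a p} {A : Set a} {P : Pred A p} (P? : Decidable P) where

  length-filter-∷ : ∀ x xs → length (filter P? (x ∷ xs)) ≡ 𝟙 (does (P? x)) + length (filter P? xs)
  length-filter-∷ x xs with does (P? x)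
  ... | true = refl
  ... | false = refl

  0<length-filter⇒Any : ∀ xs → 0 < length (filter P? xs) → Any P xs
  0<length-filter⇒Any (x ∷ xs) 0<length with P? x
  ... | yes px = here px
  ... | no _ = there (0<length-filter⇒Any xs 0<length)

  sum-𝟙≡length-filter : ∀ xs → sum (map (𝟙 ∘ does ∘ P?) xs) ≡ length (filter P? xs)
  sum-𝟙≡length-filter [] = refl
  sum-𝟙≡length-filter (x ∷ xs) =
    trans (cong (𝟙 (does (P? x)) +_) (sum-𝟙≡length-filter xs)) (sym (length-filter-∷ x xs))

module _ {a b p} {A : Set a} {B : Set b} {P : Pred B p} (P? : Decidable P) (f : A → B) where

  length-filter-map : ∀ xs → length (filter P? (map f xs)) ≡ length (filter (P? ∘ f) xs)
  length-filter-map [] = refl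
  length-filter-map (x ∷ xs) = begin
    length (filter P? (map f (x ∷ xs)))                 ≡⟨ length-filter-∷ P? (f x) (map f xs) ⟩
    𝟙 (does (P? (f x))) + length (filter P? (map f xs)) ≡⟨ cong (𝟙 (does (P? (f x))) +_) (length-filter-map xs) ⟩
    𝟙 (does (P? (f x))) + length (filter (P? ∘ f) xs)  ≡⟨ length-filter-∷ (P? ∘ f) x xs ⟨
    length (filter (P? ∘ f) (x ∷ xs))                  ∎
    where open ≡-Reasoning

module _ {a p q} {A : Set a} {P : Pred A p} {Q : Pred A q} (P? : Decidable P) (Q? : Decidable Q) where

  filter-filter : ∀ xs → filter Q? (filter P? xs) ≡ filter (λ x → P? x ×-dec Q? x) xs
  filter-filter [] = refl
  filter-filter (x ∷ xs) with P? x
  ... | no _ = filter-filter xs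
  ... | yes _ with Q? x
  ...   | yes _ = cong (x ∷_) (filter-filter xs)
  ...   | no _ = filter-filter xs

nonzero? : Decidable (λ n → n ≢ 0)
nonzero? n = ¬? (n ≟ 0)

filter-nonzero-positive : ∀ {xs} → All (0 <_) xs → filter nonzero? xs ≡ xs
filter-nonzero-positive xs>0 = filter-all nonzero? (All.map (λ x>0 → ≢-sym (<⇒≢ x>0)) xs>0)

count : ℕ → List ℕ → ℕ
count n = length ∘ filter (n ≟_)

count-∷ : ∀ n x xs → count n (x ∷ xs) ≡ 𝟙 (does (n ≟ x)) + count n xs
count-∷ n = length-filter-∷ (n ≟_)

count-++ : ∀ n xs ys → count n (xs ++ ys) ≡ count n xs + count n ys
count-++ n xs ys = trans (cong length (filter-++ (n ≟_) xs ys)) (length-++ (filter (n ≟_) xs))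

count-replicate-≡ : ∀ n m → count n (replicate m n) ≡ m
count-replicate-≡ n m = trans (cong length (filter-all (n ≟_) (replicate⁺ m refl))) (length-replicate m)

count-replicate-≢ : ∀ {n x} → n ≢ x → ∀ m → count n (replicate m x) ≡ 0
count-replicate-≢ n≢x m = cong length (filter-none (_ ≟_) (replicate⁺ m n≢x))

count-↭ : ∀ n {xs ys} → xs ↭ ys → count n xs ≡ count n ys
count-↭ n xs↭ys = ↭-length (filter-↭ (n ≟_) xs↭ys)

count-∈ : ∀ {n xs} → n ∈ xs → 0 < count n xs
count-∈ = filter-some (_ ≟_)

count-head : ∀ x xs → 0 < count x (x ∷ xs)
count-head x xs = count-∈ {x} {x ∷ xs} (here refl)

count>0⇒≤head : ∀ {n y ys} → Linked _≥_ (y ∷ ys) → 0 < count n (y ∷ ys) → n ≤ y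
count>0⇒≤head {ys = ys} y∷ys↘ 0<count =
  All.lookup (Linked⇒All (λ x≥y y≥z → ≤-trans y≥z x≥y) ≤-refl y∷ys↘) (0<length-filter⇒Any (_ ≟_) (_ ∷ ys) 0<count)

count-∷-cancel : ∀ n x {xs ys} → count n (x ∷ xs) ≡ count n (x ∷ ys) → count n xs ≡ count n ys
count-∷-cancel n x {xs} {ys} eq =
  +-cancelˡ-≡ (𝟙 (does (n ≟ x))) _ _ (trans (sym (count-∷ n x xs)) (trans eq (count-∷ n x ys)))

decreasing-≡-by-count : ∀ {xs ys} → Linked _≥_ xs → Linked _≥_ ys → (∀ n → count n xs ≡ count n ys) → xs ≡ ys
decreasing-≡-by-count {[]} {[]} _ _ _ = refl
decreasing-≡-by-count {[]} {y ∷ ys} _ _ same with subst (0 <_) (sym (same y)) (count-head y ys)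
... | ()
decreasing-≡-by-count {x ∷ xs} {[]} _ _ same with subst (0 <_) (same x) (count-head x xs)
... | ()
decreasing-≡-by-count {x ∷ xs} {y ∷ ys} xs↘ ys↘ same
  with ≤-antisym (count>0⇒≤head ys↘ (subst (0 <_) (same x) (count-head x xs)))
                 (count>0⇒≤head xs↘ (subst (0 <_) (sym (same y)) (count-head y ys)))
... | refl = cong (x ∷_) (decreasing-≡-by-count (Linked.tail xs↘) (Linked.tail ys↘) λ n → count-∷-cancel n x (same n))

∑ : ∀ {n} → (Fin n → ℕ) → ℕ
∑ f = sum (tabulate f)

∑-cong : ∀ {n} {f g : Fin n → ℕ} → (∀ c → f c ≡ g c) → ∑ f ≡ ∑ g
∑-cong f≗g = cong sum (tabulate-cong f≗g)

∑-+ : ∀ {n} (f g : Fin n → ℕ) → ∑ (λ c → f c + g c) ≡ ∑ f + ∑ g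
∑-+ {zero} f g = refl
∑-+ {suc n} f g = trans (cong (f zero + g zero +_) (∑-+ (f ∘ suc) (g ∘ suc)))
                        (interchange +-commutativeSemigroup (f zero) (g zero) _ _)

∑-*ˡ : ∀ {n} m (f : Fin n → ℕ) → ∑ (λ c → m * f c) ≡ m * ∑ f
∑-*ˡ {zero} m f = sym (*-zeroʳ m)
∑-*ˡ {suc n} m f = trans (cong (m * f zero +_) (∑-*ˡ m (f ∘ suc))) (sym (*-distribˡ-+ m (f zero) _))

∑-𝟙≟* : ∀ {n} (d : Fin n) (F : Fin n → ℕ) → ∑ (λ c → 𝟙 (does (d Fin.≟ c)) * F c) ≡ F d
∑-𝟙≟* {suc n} zero F = trans (cong (F zero + 0 +_) (∑-*ˡ 0 (F ∘ suc))) (trans (+-identityʳ _) (+-identityʳ _))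
∑-𝟙≟* {suc n} (suc d) F = ∑-𝟙≟* d (F ∘ suc)

sum-allFin : ∀ {n} (f : Fin n → ℕ) → sum (map f (allFin n)) ≡ ∑ f
sum-allFin f = cong sum (map-tabulate (λ i → i) f)

module _ {a} {A : Set a} {f g : A → ℕ} (f≤g : ∀ x → f x ≤ g x) where

  sum-map-mono : ∀ xs → sum (map f xs) ≤ sum (map g xs)
  sum-map-mono [] = z≤n
  sum-map-mono (x ∷ xs) = +-mono-≤ (f≤g x) (sum-map-mono xs)

  sum-map-≡⇒≡ : ∀ xs → sum (map f xs) ≡ sum (map g xs) → ∀ {x} → x ∈ xs → f x ≡ g x
  sum-map-≡⇒≡ (y ∷ ys) eq x∈xs with m≤n⇒m<n∨m≡n (f≤g y)
  ... | inj₁ fy<gy = ⊥-elim (<⇒≢ (+-mono-<-≤ fy<gy (sum-map-mono ys)) eq)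
  sum-map-≡⇒≡ (y ∷ ys) eq (here refl) | inj₂ fy≡gy = fy≡gy
  sum-map-≡⇒≡ (y ∷ ys) eq (there x∈ys) | inj₂ fy≡gy =
    sum-map-≡⇒≡ ys (+-cancelˡ-≡ (f y) _ _ (trans eq (cong (_+ _) (sym fy≡gy)))) x∈ys

length≤sum : ∀ {xs} → All (0 <_) xs → length xs ≤ sum xs
length≤sum [] = z≤n
length≤sum (x>0 ∷ xs>0) = +-mono-≤ x>0 (length≤sum xs>0)

-- Counting the blocks of a set partition through its elements

blockSizeOf : ∀ {k} → SetPartition k → Fin k → ℕ
blockSizeOf π i = blockSize π (π i)

blockSizeOf-positive : ∀ {k} (π : SetPartition k) i → 1 ≤ blockSizeOf π i
blockSizeOf-positive π i = filter-some (λ j → π j Fin.≟ π i) (Any.map (λ { refl → refl }) (∈-allFin i))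

blockSize≤ : ∀ {k} (π : SetPartition k) c → blockSize π c ≤ k
blockSize≤ {k} π c = ≤-trans (length-filter _ (allFin k)) (≤-reflexive (length-tabulate (λ i → i)))

module _ {k : ℕ} (π : SetPartition k) where

  blockSizeIn : List (Fin k) → Fin k → ℕ
  blockSizeIn xs c = length (filter (λ i → π i Fin.≟ c) xs)

  sum-∘-by-blocks : ∀ (F : Fin k → ℕ) xs → sum (map (F ∘ π) xs) ≡ ∑ (λ c → blockSizeIn xs c * F c)
  sum-∘-by-blocks F [] = sym (∑-*ˡ 0 F)
  sum-∘-by-blocks F (x ∷ xs) = begin
    F (π x) + sum (map (F ∘ π) xs)
      ≡⟨ cong₂ _+_ (sym (∑-𝟙≟* (π x) F)) (sum-∘-by-blocks F xs) ⟩
    ∑ (λ c → 𝟙 (does (π x Fin.≟ c)) * F c) + ∑ (λ c → blockSizeIn xs c * F c)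
      ≡⟨ ∑-+ (λ c → 𝟙 (does (π x Fin.≟ c)) * F c) (λ c → blockSizeIn xs c * F c) ⟨
    ∑ (λ c → 𝟙 (does (π x Fin.≟ c)) * F c + blockSizeIn xs c * F c)
      ≡⟨ ∑-cong (λ c → trans (cong (_* F c) (length-filter-∷ (λ i → π i Fin.≟ c) x xs))
                              (*-distribʳ-+ (F c) (𝟙 (does (π x Fin.≟ c))) (blockSizeIn xs c))) ⟨
    ∑ (λ c → blockSizeIn (x ∷ xs) c * F c)
      ∎
    where open ≡-Reasoning

  -- A block of size s contributes s · w s to the left-hand side.
  sum-weight-blockSizeOf : ∀ {p} {P : Pred ℕ p} (P? : Decidable P) (w : ℕ → ℕ) m →
    (∀ s → s ≤ k → s * w s ≡ m * 𝟙 (does (P? s))) →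
    sum (map (w ∘ blockSizeOf π) (allFin k)) ≡ m * length (filter P? (map (blockSize π) (allFin k)))
  sum-weight-blockSizeOf P? w m s*w≡ = begin
    sum (map (w ∘ blockSizeOf π) (allFin k))                   ≡⟨ sum-∘-by-blocks (w ∘ blockSize π) (allFin k) ⟩
    ∑ (λ c → blockSize π c * w (blockSize π c))                ≡⟨ ∑-cong (λ c → s*w≡ (blockSize π c) (blockSize≤ π c)) ⟩
    ∑ (λ c → m * 𝟙 (does (P? (blockSize π c))))                 ≡⟨ ∑-*ˡ m (𝟙 ∘ does ∘ P? ∘ blockSize π) ⟩
    m * ∑ (𝟙 ∘ does ∘ P? ∘ blockSize π)                         ≡⟨ cong (m *_) (sum-allFin (𝟙 ∘ does ∘ P? ∘ blockSize π)) ⟨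
    m * sum (map (𝟙 ∘ does ∘ P? ∘ blockSize π) (allFin k))      ≡⟨ cong (m *_) (cong sum (map-∘ (allFin k))) ⟩
    m * sum (map (𝟙 ∘ does ∘ P?) (map (blockSize π) (allFin k))) ≡⟨ cong (m *_) (sum-𝟙≡length-filter P? (map (blockSize π) (allFin k))) ⟩
    m * length (filter P? (map (blockSize π) (allFin k)))       ∎
    where open ≡-Reasoning

module _ (k : ℕ) where

  -- The junk value share 0 = 0 is never used: block sizes are positive.
  share : ℕ → ℕ
  share zero = 0
  share s@(suc _) = k ! / s

  *-share : ∀ s → 1 ≤ s → s ≤ k → s * share s ≡ k !
  *-share s@(suc t) _ s≤k = m*[n/m]≡n (∣-trans (m∣m*n (t !)) (m≤n⇒m!∣n! s≤k))

  share-antitone : ∀ {s t} → 1 ≤ s → s ≤ t → share t ≤ share s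
  share-antitone {suc _} {suc _} _ s≤t = /-monoʳ-≤ (k !) s≤t

  share-injective : ∀ {s t} → 1 ≤ s → s ≤ k → 1 ≤ t → t ≤ k → share s ≡ share t → s ≡ t
  share-injective {s} {t} 1≤s s≤k 1≤t t≤k eq =
    *-cancelʳ-≡ s t (share s) {{share≢0}} (trans (*-share s 1≤s s≤k) (sym (trans (cong (t *_) eq) (*-share t 1≤t t≤k))))
    where
    share≢0 : NonZero (share s)
    share≢0 = ≢-nonZero λ share≡0 → ≢-nonZero⁻¹ (k !) {{k !≢0}}
      (trans (sym (*-share s 1≤s s≤k)) (trans (cong (s *_) share≡0) (*-zeroʳ s)))

module _ {k : ℕ} (π : SetPartition k) where

  k!*length-blockSizes : k ! * length (blockSizes π) ≡ sum (map (share k ∘ blockSizeOf π) (allFin k))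
  k!*length-blockSizes = sym (sum-weight-blockSizeOf π nonzero? (share k) (k !) s*share)
    where
    s*share : ∀ s → s ≤ k → s * share k s ≡ k ! * 𝟙 (does (nonzero? s))
    s*share zero _ = sym (*-zeroʳ (k !))
    s*share s@(suc _) s≤k = trans (*-share k s (s≤s z≤n) s≤k) (sym (*-identityʳ (k !)))

  *-count-blockSizes : ∀ s → s ≢ 0 →
    s * count s (blockSizes π) ≡ sum (map (λ i → 𝟙 (does (s ≟ blockSizeOf π i))) (allFin k))
  *-count-blockSizes s s≢0 = begin
    s * count s (blockSizes π)
      ≡⟨ cong (λ xs → s * length xs) (filter-filter nonzero? (s ≟_) sizes) ⟩
    s * length (filter (λ t → nonzero? t ×-dec (s ≟ t)) sizes)
      ≡⟨ cong (λ xs → s * length xs) (filter-≐ (λ t → nonzero? t ×-dec (s ≟ t)) (s ≟_) (proj₂ , λ { refl → s≢0 , refl }) sizes) ⟩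
    s * length (filter (s ≟_) sizes)
      ≡⟨ sum-weight-blockSizeOf π (s ≟_) (λ t → 𝟙 (does (s ≟ t))) s t*𝟙 ⟨
    sum (map (λ i → 𝟙 (does (s ≟ blockSizeOf π i))) (allFin k))
      ∎
    where
    open ≡-Reasoning
    sizes = map (blockSize π) (allFin k)
    t*𝟙 : ∀ t → t ≤ k → t * 𝟙 (does (s ≟ t)) ≡ s * 𝟙 (does (s ≟ t))
    t*𝟙 t _ with s ≟ t
    ... | yes refl = refl
    ... | no s≢t rewrite dec-false (s ≟ t) s≢t = trans (*-zeroʳ t) (sym (*-zeroʳ s))

  count0-blockSizes : count 0 (blockSizes π) ≡ 0
  count0-blockSizes = cong length (filter-none (0 ≟_)
    (All.map (λ n≢0 0≡n → n≢0 (sym 0≡n)) (all-filter nonzero? (map (blockSize π) (allFin k)))))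

blockSizeOf-≗⇒count-≡ : ∀ {k} (π σ : SetPartition k) → (∀ i → blockSizeOf σ i ≡ blockSizeOf π i) →
  ∀ n → count n (blockSizes σ) ≡ count n (blockSizes π)
blockSizeOf-≗⇒count-≡ π σ same zero = trans (count0-blockSizes σ) (sym (count0-blockSizes π))
blockSizeOf-≗⇒count-≡ {k} π σ same n@(suc _) = *-cancelˡ-≡ _ _ n (begin
  n * count n (blockSizes σ)                                    ≡⟨ *-count-blockSizes σ n (λ ()) ⟩
  sum (map (λ i → 𝟙 (does (n ≟ blockSizeOf σ i))) (allFin k))   ≡⟨ cong sum (map-cong (λ i → cong (λ t → 𝟙 (does (n ≟ t))) (same i)) (allFin k)) ⟩
  sum (map (λ i → 𝟙 (does (n ≟ blockSizeOf π i))) (allFin k))   ≡⟨ *-count-blockSizes π n (λ ()) ⟨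
  n * count n (blockSizes π)                                    ∎)
  where open ≡-Reasoning

module _ {k : ℕ} {π σ : SetPartition k} (π≤σ : π ≤ʳ σ) where

  blockSizeOf-mono : ∀ i → blockSizeOf π i ≤ blockSizeOf σ i
  blockSizeOf-mono i = Sublist.length-mono-≤ (Sublist.filter⁺ (λ j → π j Fin.≟ π i) (λ j → σ j Fin.≟ σ i)
    (λ { refl πj≡πi → π≤σ _ i πj≡πi }) (⊆-refl {x = allFin k}))

  share-blockSizeOf-antitone : ∀ i → share k (blockSizeOf σ i) ≤ share k (blockSizeOf π i)
  share-blockSizeOf-antitone i = share-antitone k (blockSizeOf-positive π i) (blockSizeOf-mono i)

  length-blockSizes-antitone : length (blockSizes σ) ≤ length (blockSizes π)
  length-blockSizes-antitone = *-cancelˡ-≤ (k !) {{k !≢0}} (begin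
    k ! * length (blockSizes σ)                     ≡⟨ k!*length-blockSizes σ ⟩
    sum (map (share k ∘ blockSizeOf σ) (allFin k))  ≤⟨ sum-map-mono share-blockSizeOf-antitone (allFin k) ⟩
    sum (map (share k ∘ blockSizeOf π) (allFin k))  ≡⟨ k!*length-blockSizes π ⟨
    k ! * length (blockSizes π)                     ∎)
    where open ≤-Reasoning

  length-blockSizes-≡⇒blockSizeOf-≡ : length (blockSizes σ) ≡ length (blockSizes π) →
    ∀ i → blockSizeOf σ i ≡ blockSizeOf π i
  length-blockSizes-≡⇒blockSizeOf-≡ same-length i =
    share-injective k (blockSizeOf-positive σ i) (blockSize≤ σ (σ i)) (blockSizeOf-positive π i) (blockSize≤ π (π i))
      (sum-map-≡⇒≡ share-blockSizeOf-antitone (allFin k) same-sum (∈-allFin i))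
    where
    same-sum : sum (map (share k ∘ blockSizeOf σ) (allFin k)) ≡ sum (map (share k ∘ blockSizeOf π) (allFin k))
    same-sum = trans (sym (k!*length-blockSizes σ)) (trans (cong (k ! *_) same-length) (k!*length-blockSizes π))

≺⇒length< : ∀ {k μ λs} → Linked _≥_ μ → Linked _≥_ λs → μ ≺[ k ] λs → length μ < length λs
≺⇒length< {μ = μ} {λs} μ↘ λs↘ ((_ , πs , typeλs , σ , (πs≤σ , _) , typeμ) , μ≢λs) = ≤∧≢⇒< length≤ length≢
  where
  π = πs zero
  length≤ : length μ ≤ length λs
  length≤ = subst₂ _≤_ (↭-length typeμ) (↭-length (typeλs zero)) (length-blockSizes-antitone (πs≤σ zero))
  length≢ : length μ ≢ length λs
  length≢ same-length = μ≢λs (decreasing-≡-by-count μ↘ λs↘ λ n → begin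
    count n μ               ≡⟨ count-↭ n typeμ ⟨
    count n (blockSizes σ)  ≡⟨ blockSizeOf-≗⇒count-≡ π σ (length-blockSizes-≡⇒blockSizeOf-≡ (πs≤σ zero) same-size) n ⟩
    count n (blockSizes π)  ≡⟨ count-↭ n (typeλs zero) ⟩
    count n λs              ∎)
    where
    open ≡-Reasoning
    same-size : length (blockSizes σ) ≡ length (blockSizes π)
    same-size = trans (↭-length typeμ) (trans same-length (sym (↭-length (typeλs zero))))

module _ {a} {A : Set a} (_≟ₐ_ : DecidableEquality A) where

  ↭-∷-filter-≢ : ∀ {x xs} → Unique xs → x ∈ xs → xs ↭ x ∷ filter (λ y → ¬? (y ≟ₐ x)) xs
  ↭-∷-filter-≢ {x} {x ∷ ys} (x∉ys ∷ _) (here refl) = ↭-prep x (↭-reflexive (sym (begin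
    filter (λ y → ¬? (y ≟ₐ x)) (x ∷ ys) ≡⟨ filter-reject (λ y → ¬? (y ≟ₐ x)) (λ x≢x → x≢x refl) ⟩
    filter (λ y → ¬? (y ≟ₐ x)) ys       ≡⟨ filter-all (λ y → ¬? (y ≟ₐ x)) (All.map ≢-sym x∉ys) ⟩
    ys                                 ∎)))
    where open ≡-Reasoning
  ↭-∷-filter-≢ {x} {y ∷ ys} (y∉ys ∷ ys!) (there x∈ys) = begin
    y ∷ ys                                   ↭⟨ ↭-prep y (↭-∷-filter-≢ ys! x∈ys) ⟩
    y ∷ x ∷ filter (λ z → ¬? (z ≟ₐ x)) ys    ↭⟨ ↭-swap y x ↭-refl ⟩
    x ∷ y ∷ filter (λ z → ¬? (z ≟ₐ x)) ys    ≡⟨ cong (x ∷_) (filter-accept (λ z → ¬? (z ≟ₐ x)) (All.lookup y∉ys x∈ys)) ⟨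
    x ∷ filter (λ z → ¬? (z ≟ₐ x)) (y ∷ ys)  ∎
    where open PermutationReasoning

removeTwo-↭ : ∀ λs (i j : Fin (length λs)) → i ≢ j → λs ↭ lookup λs i ∷ lookup λs j ∷ removeTwo λs i j
removeTwo-↭ λs i j i≢j = begin
  λs
    ≡⟨ trans (map-tabulate (λ m → m) (lookup λs)) (tabulate-lookup λs) ⟨
  map (lookup λs) (allFin n)
    ↭⟨ map⁺ (lookup λs) (↭-∷-filter-≢ Fin._≟_ (Unique.allFin⁺ n) (∈-allFin i)) ⟩
  map (lookup λs) (i ∷ others)
    ↭⟨ ↭-prep (lookup λs i) (map⁺ (lookup λs) (↭-∷-filter-≢ Fin._≟_ (Unique.filter⁺ _ (Unique.allFin⁺ n)) j∈others)) ⟩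
  map (lookup λs) (i ∷ j ∷ filter (λ m → ¬? (m Fin.≟ j)) others)
    ≡⟨ cong (λ ms → map (lookup λs) (i ∷ j ∷ ms)) (filter-filter (λ m → ¬? (m Fin.≟ i)) (λ m → ¬? (m Fin.≟ j)) (allFin n)) ⟩
  lookup λs i ∷ lookup λs j ∷ removeTwo λs i j
    ∎
  where
  open PermutationReasoning
  n = length λs
  others = filter (λ m → ¬? (m Fin.≟ i)) (allFin n)
  j∈others : j ∈ others
  j∈others = ∈-filter⁺ (λ m → ¬? (m Fin.≟ i)) (∈-allFin j) (≢-sym i≢j)

-- Set partitions given by labellings

lookup₀ : List ℕ → ℕ → ℕ
lookup₀ [] _ = 0
lookup₀ (x ∷ xs) zero = x
lookup₀ (x ∷ xs) (suc n) = lookup₀ xs n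

lookup₀-≥ : ∀ xs {n} → length xs ≤ n → lookup₀ xs n ≡ 0
lookup₀-≥ [] _ = refl
lookup₀-≥ (x ∷ xs) (s≤s xs≤n) = lookup₀-≥ xs xs≤n

tabulate-lookup₀ : ∀ xs → tabulate {n = length xs} (lookup₀ xs ∘ toℕ) ≡ xs
tabulate-lookup₀ [] = refl
tabulate-lookup₀ (x ∷ xs) = cong (x ∷_) (tabulate-lookup₀ xs)

tabulate-lookup₀-pad : ∀ xs {m} → length xs ≤ m → tabulate {n = m} (lookup₀ xs ∘ toℕ) ≡ xs ++ replicate (m ∸ length xs) 0
tabulate-lookup₀-pad [] {zero} _ = refl
tabulate-lookup₀-pad [] {suc m} _ = cong (0 ∷_) (tabulate-lookup₀-pad [] z≤n)
tabulate-lookup₀-pad (x ∷ xs) (s≤s xs≤m) = cong (x ∷_) (tabulate-lookup₀-pad xs xs≤m)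

-- Labels are read modulo k; all labellings used below take values below k.
fromLabels : ∀ {n} → (Fin (suc n) → ℕ) → SetPartition (suc n)
fromLabels {n} ℓ i = ℓ i mod suc n

module _ {n : ℕ} where

  private
    k = suc n

  toℕ-mod : ∀ {x} → x < k → toℕ (x mod k) ≡ x
  toℕ-mod x<k = trans (toℕ-fromℕ< _) (m<n⇒m%n≡m x<k)

  fromLabels-≡⇒ : ∀ {ℓ : Fin k → ℕ} → (∀ i → ℓ i < k) → ∀ {i j} → fromLabels ℓ i ≡ fromLabels ℓ j → ℓ i ≡ ℓ j
  fromLabels-≡⇒ ℓ<k {i} {j} same = trans (sym (toℕ-mod (ℓ<k i))) (trans (cong toℕ same) (toℕ-mod (ℓ<k j)))

  fromLabels-≤ʳ : ∀ {ℓ ℓ′ : Fin k → ℕ} → (∀ i → ℓ i < k) → (∀ i j → ℓ i ≡ ℓ j → ℓ′ i ≡ ℓ′ j) →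
    fromLabels ℓ ≤ʳ fromLabels ℓ′
  fromLabels-≤ʳ ℓ<k ℓ⇒ℓ′ i j same = cong (_mod k) (ℓ⇒ℓ′ i j (fromLabels-≡⇒ ℓ<k same))

  HasMultiplicities : (Fin k → ℕ) → List ℕ → Set
  HasMultiplicities ℓ xs = ∀ m → count m (map ℓ (allFin k)) ≡ lookup₀ xs m

  module _ {ℓ : Fin k → ℕ} {xs : List ℕ} (mult : HasMultiplicities ℓ xs) (xs≤k : length xs ≤ k) where

    labels< : ∀ i → ℓ i < k
    labels< i with ℓ i <? k
    ... | yes ℓi<k = ℓi<k
    ... | no ℓi≮k = ⊥-elim (<-irrefl refl (begin-strict
      0                               <⟨ count-∈ (∈-map⁺ ℓ (∈-allFin i)) ⟩
      count (ℓ i) (map ℓ (allFin k))  ≡⟨ mult (ℓ i) ⟩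
      lookup₀ xs (ℓ i)                ≡⟨ lookup₀-≥ xs (≤-trans xs≤k (≮⇒≥ ℓi≮k)) ⟩
      0                               ∎))
      where open ≤-Reasoning

    blockSize-fromLabels : ∀ c → blockSize (fromLabels ℓ) c ≡ lookup₀ xs (toℕ c)
    blockSize-fromLabels c = begin
      length (filter (λ i → fromLabels ℓ i Fin.≟ c) (allFin k))
        ≡⟨ cong length (filter-≐ (λ i → fromLabels ℓ i Fin.≟ c) ((toℕ c ≟_) ∘ ℓ) same-label (allFin k)) ⟩
      length (filter ((toℕ c ≟_) ∘ ℓ) (allFin k))
        ≡⟨ length-filter-map (toℕ c ≟_) ℓ (allFin k) ⟨
      count (toℕ c) (map ℓ (allFin k))
        ≡⟨ mult (toℕ c) ⟩
      lookup₀ xs (toℕ c)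
        ∎
      where
      open ≡-Reasoning
      same-label : (λ i → fromLabels ℓ i ≡ c) ≐ (λ i → toℕ c ≡ ℓ i)
      same-label = (λ {i} ℓi≡c → trans (cong toℕ (sym ℓi≡c)) (toℕ-mod (labels< i)))
                 , (λ {i} c≡ℓi → toℕ-injective (trans (toℕ-mod (labels< i)) (sym c≡ℓi)))

    blockSizes-fromLabels : blockSizes (fromLabels ℓ) ≡ filter nonzero? xs
    blockSizes-fromLabels = begin
      filter nonzero? (map (blockSize (fromLabels ℓ)) (allFin k))
        ≡⟨ cong (filter nonzero?) (map-cong blockSize-fromLabels (allFin k)) ⟩
      filter nonzero? (map (lookup₀ xs ∘ toℕ) (allFin k))
        ≡⟨ cong (filter nonzero?) (trans (map-tabulate (λ i → i) (lookup₀ xs ∘ toℕ)) (tabulate-lookup₀-pad xs xs≤k)) ⟩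
      filter nonzero? (xs ++ replicate (k ∸ length xs) 0)
        ≡⟨ filter-++ nonzero? xs _ ⟩
      filter nonzero? xs ++ filter nonzero? (replicate (k ∸ length xs) 0)
        ≡⟨ cong (filter nonzero? xs ++_) (filter-none nonzero? (replicate⁺ (k ∸ length xs) λ 0≢0 → 0≢0 refl)) ⟩
      filter nonzero? xs ++ []
        ≡⟨ ++-identityʳ _ ⟩
      filter nonzero? xs
        ∎
      where open ≡-Reasoning

blockLabels : ℕ → List ℕ → List ℕ
blockLabels o [] = []
blockLabels o (x ∷ xs) = replicate x o ++ blockLabels (suc o) xs

length-blockLabels : ∀ o xs → length (blockLabels o xs) ≡ sum xs
length-blockLabels o [] = refl
length-blockLabels o (x ∷ xs) =
  trans (length-++ (replicate x o)) (cong₂ _+_ (length-replicate x) (length-blockLabels (suc o) xs))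

count-blockLabels-< : ∀ {n o} → n < o → ∀ xs → count n (blockLabels o xs) ≡ 0
count-blockLabels-< n<o [] = refl
count-blockLabels-< {n} {o} n<o (x ∷ xs) = trans (count-++ n (replicate x o) _)
  (cong₂ _+_ (count-replicate-≢ (<⇒≢ n<o) x) (count-blockLabels-< (m<n⇒m<1+n n<o) xs))

count-blockLabels : ∀ o p xs → count (o + p) (blockLabels o xs) ≡ lookup₀ xs p
count-blockLabels o p [] = refl
count-blockLabels o zero (x ∷ xs) = begin
  count (o + 0) (replicate x o ++ blockLabels (suc o) xs)
    ≡⟨ cong (λ n → count n (replicate x o ++ blockLabels (suc o) xs)) (+-identityʳ o) ⟩
  count o (replicate x o ++ blockLabels (suc o) xs)
    ≡⟨ count-++ o (replicate x o) _ ⟩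
  count o (replicate x o) + count o (blockLabels (suc o) xs)
    ≡⟨ cong₂ _+_ (count-replicate-≡ o x) (count-blockLabels-< (n<1+n o) xs) ⟩
  x + 0
    ≡⟨ +-identityʳ x ⟩
  x ∎
  where open ≡-Reasoning
count-blockLabels o (suc p) (x ∷ xs) = begin
  count (o + suc p) (replicate x o ++ blockLabels (suc o) xs)
    ≡⟨ count-++ (o + suc p) (replicate x o) _ ⟩
  count (o + suc p) (replicate x o) + count (o + suc p) (blockLabels (suc o) xs)
    ≡⟨ cong₂ _+_ (count-replicate-≢ (m+1+n≢m o) x) (cong (λ n → count n (blockLabels (suc o) xs)) (+-suc o p)) ⟩
  0 + count (suc o + p) (blockLabels (suc o) xs)
    ≡⟨ count-blockLabels (suc o) p xs ⟩
  lookup₀ xs p ∎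
  where open ≡-Reasoning

-- Merging two blocks

merge01 : ℕ → ℕ
merge01 (suc zero) = zero
merge01 n = n

merge01-≡ : ∀ {x y} → merge01 x ≡ merge01 y → x ≡ y ⊎ (merge01 x ≡ 0 × merge01 y ≡ 0)
merge01-≡ {suc (suc _)} {suc (suc _)} eq = inj₁ eq
merge01-≡ {zero} {zero} _ = inj₂ (refl , refl)
merge01-≡ {zero} {suc zero} _ = inj₂ (refl , refl)
merge01-≡ {suc zero} {zero} _ = inj₂ (refl , refl)
merge01-≡ {suc zero} {suc zero} _ = inj₂ (refl , refl)
merge01-≡ {zero} {suc (suc _)} ()
merge01-≡ {suc zero} {suc (suc _)} ()
merge01-≡ {suc (suc _)} {zero} ()
merge01-≡ {suc (suc _)} {suc zero} ()

count0-map-merge01 : ∀ xs → count 0 (map merge01 xs) ≡ count 0 xs + count 1 xs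
count0-map-merge01 [] = refl
count0-map-merge01 (zero ∷ xs) = cong suc (count0-map-merge01 xs)
count0-map-merge01 (suc zero ∷ xs) = trans (cong suc (count0-map-merge01 xs)) (sym (+-suc _ _))
count0-map-merge01 (suc (suc _) ∷ xs) = count0-map-merge01 xs

count1-map-merge01 : ∀ xs → count 1 (map merge01 xs) ≡ 0
count1-map-merge01 [] = refl
count1-map-merge01 (zero ∷ xs) = count1-map-merge01 xs
count1-map-merge01 (suc zero ∷ xs) = count1-map-merge01 xs
count1-map-merge01 (suc (suc _) ∷ xs) = count1-map-merge01 xs

count2+-map-merge01 : ∀ n xs → count (2 + n) (map merge01 xs) ≡ count (2 + n) xs
count2+-map-merge01 n [] = refl
count2+-map-merge01 n (zero ∷ xs) = count2+-map-merge01 n xs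
count2+-map-merge01 n (suc zero ∷ xs) = count2+-map-merge01 n xs
count2+-map-merge01 n (x@(suc (suc _)) ∷ xs) =
  trans (count-∷ (2 + n) x _) (trans (cong (_ +_) (count2+-map-merge01 n xs)) (sym (count-∷ (2 + n) x xs)))

merge01-multiplicities : ∀ {n} {ℓ : Fin (suc n) → ℕ} {a b ρs} → HasMultiplicities ℓ (a ∷ b ∷ ρs) →
  HasMultiplicities (merge01 ∘ ℓ) ((a + b) ∷ 0 ∷ ρs)
merge01-multiplicities {n} {ℓ} mult m = trans (cong (count m) (map-∘ (allFin (suc n)))) (merged m)
  where
  labels = map ℓ (allFin (suc n))
  merged : ∀ m → count m (map merge01 labels) ≡ lookup₀ (_ ∷ 0 ∷ _) m
  merged zero = trans (count0-map-merge01 labels) (cong₂ _+_ (mult 0) (mult 1))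
  merged (suc zero) = count1-map-merge01 labels
  merged (suc (suc p)) = trans (count2+-map-merge01 p labels) (mult (suc (suc p)))

-- Elements 0, 1, 2 carry labels 0, 1, 0 under ℓ₀ and 1, 0, 0 under ℓ₁; the rest is labelled
-- alike.  So ℓ₁ swaps an element of block 0 with one of block 1, and element 2 (the pivot)
-- keeps both blocks linked in any common coarsening.
module Pivot (a b : ℕ) (ρs : List ℕ) (ρs>0 : All (0 <_) ρs) where

  rest : List ℕ
  rest = blockLabels 0 (a ∷ b ∷ ρs)

  n : ℕ
  n = 2 + length rest

  ℓ₀ ℓ₁ : Fin (suc n) → ℕ
  ℓ₀ i = lookup₀ (0 ∷ 1 ∷ 0 ∷ rest) (toℕ i)
  ℓ₁ i = lookup₀ (1 ∷ 0 ∷ 0 ∷ rest) (toℕ i)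

  count-labels₀ : ∀ m → count m (0 ∷ 1 ∷ 0 ∷ rest) ≡ lookup₀ ((2 + a) ∷ (1 + b) ∷ ρs) m
  count-labels₀ zero = cong (2 +_) (count-blockLabels 0 0 (a ∷ b ∷ ρs))
  count-labels₀ (suc zero) = cong suc (count-blockLabels 0 1 (a ∷ b ∷ ρs))
  count-labels₀ (suc (suc p)) = count-blockLabels 0 (2 + p) (a ∷ b ∷ ρs)

  mult₀ : HasMultiplicities ℓ₀ ((2 + a) ∷ (1 + b) ∷ ρs)
  mult₀ m = trans (cong (count m) (trans (map-tabulate (λ i → i) ℓ₀) (tabulate-lookup₀ (0 ∷ 1 ∷ 0 ∷ rest)))) (count-labels₀ m)

  mult₁ : HasMultiplicities ℓ₁ ((2 + a) ∷ (1 + b) ∷ ρs)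
  mult₁ m = trans (cong (count m) (trans (map-tabulate (λ i → i) ℓ₁) (tabulate-lookup₀ (1 ∷ 0 ∷ 0 ∷ rest))))
                  (trans (count-↭ m (↭-swap 1 0 ↭-refl)) (count-labels₀ m))

  multσ : HasMultiplicities (merge01 ∘ ℓ₀) ((2 + a + (1 + b)) ∷ 0 ∷ ρs)
  multσ = merge01-multiplicities mult₀

  merge01∘ℓ₁ : ∀ i → merge01 (ℓ₁ i) ≡ merge01 (ℓ₀ i)
  merge01∘ℓ₁ zero = refl
  merge01∘ℓ₁ (suc zero) = refl
  merge01∘ℓ₁ (suc (suc zero)) = refl
  merge01∘ℓ₁ (suc (suc (suc _))) = refl

  length≤ : length ((2 + a) ∷ (1 + b) ∷ ρs) ≤ suc n
  length≤ = s≤s (s≤s (≤-trans (length≤sum ρs>0) (begin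
    sum ρs             ≤⟨ m≤n+m (sum ρs) (a + b) ⟩
    a + b + sum ρs     ≡⟨ +-assoc a b (sum ρs) ⟩
    a + (b + sum ρs)   ≡⟨ length-blockLabels 0 (a ∷ b ∷ ρs) ⟨
    length rest        ≤⟨ n≤1+n (length rest) ⟩
    suc (length rest)  ∎)))
    where open ≤-Reasoning

  size : suc n ≡ sum ((2 + a) ∷ (1 + b) ∷ ρs)
  size = trans (cong (3 +_) (length-blockLabels 0 (a ∷ b ∷ ρs))) (cong (2 +_) (sym (+-suc a (b + sum ρs))))

  πs : Fin 2 → SetPartition (suc n)
  πs zero = fromLabels ℓ₀
  πs (suc zero) = fromLabels ℓ₁

  σ : SetPartition (suc n)
  σ = fromLabels (merge01 ∘ ℓ₀)

  πs≤σ : ∀ t → πs t ≤ʳ σ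
  πs≤σ zero = fromLabels-≤ʳ (labels< mult₀ length≤) (λ _ _ → cong merge01)
  πs≤σ (suc zero) = fromLabels-≤ʳ (labels< mult₁ length≤) λ i j ℓ₁i≡ℓ₁j →
    trans (sym (merge01∘ℓ₁ i)) (trans (cong merge01 ℓ₁i≡ℓ₁j) (merge01∘ℓ₁ j))

  σ-least : ∀ τ → (∀ t → πs t ≤ʳ τ) → σ ≤ʳ τ
  σ-least τ πs≤τ i j σi≡σj with merge01-≡ {ℓ₀ i} {ℓ₀ j} (fromLabels-≡⇒ (labels< multσ length≤) {i} {j} σi≡σj)
  ... | inj₁ ℓ₀i≡ℓ₀j = πs≤τ zero i j (cong (_mod suc n) ℓ₀i≡ℓ₀j)
  ... | inj₂ (i↦0 , j↦0) = trans (to-pivot i i↦0) (sym (to-pivot j j↦0))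
    where
    pivot : Fin (suc n)
    pivot = suc (suc zero)
    to-pivot : ∀ i → merge01 (ℓ₀ i) ≡ 0 → τ i ≡ τ pivot
    to-pivot i _ with ℓ₀ i in ℓ₀i≡
    ... | zero = πs≤τ zero i pivot (cong (_mod suc n) ℓ₀i≡)
    ... | suc zero = trans (πs≤τ zero i (suc zero) (cong (_mod suc n) ℓ₀i≡)) (πs≤τ (suc zero) (suc zero) pivot refl)

  pivot-⪯ : ((2 + a + (1 + b)) ∷ ρs) ⪯[ sum ((2 + a) ∷ (1 + b) ∷ ρs) ] ((2 + a) ∷ (1 + b) ∷ ρs)
  pivot-⪯ = subst (λ k → ((2 + a + (1 + b)) ∷ ρs) ⪯[ k ] ((2 + a) ∷ (1 + b) ∷ ρs)) size
    (1 , πs , typeλs , σ , (πs≤σ , σ-least) , typeμ)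
    where
    λs>0 : All (0 <_) ((2 + a) ∷ (1 + b) ∷ ρs)
    λs>0 = s≤s z≤n ∷ s≤s z≤n ∷ ρs>0
    typeλs : ∀ t → HasType (πs t) ((2 + a) ∷ (1 + b) ∷ ρs)
    typeλs zero = ↭-reflexive (trans (blockSizes-fromLabels mult₀ length≤) (filter-nonzero-positive λs>0))
    typeλs (suc zero) = ↭-reflexive (trans (blockSizes-fromLabels mult₁ length≤) (filter-nonzero-positive λs>0))
    typeμ : HasType σ ((2 + a + (1 + b)) ∷ ρs)
    typeμ = ↭-reflexive (trans (blockSizes-fromLabels multσ length≤) (cong (_ ∷_) (filter-nonzero-positive ρs>0)))

⪯-resp-↭ : ∀ {k μ μ′ λs λs′} → μ ↭ μ′ → λs ↭ λs′ → μ ⪯[ k ] λs → μ′ ⪯[ k ] λs′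
⪯-resp-↭ μ↭μ′ λs↭λs′ (ℓ , πs , typeλs , σ , join , typeμ) =
  ℓ , πs , (λ t → ↭-trans (typeλs t) λs↭λs′) , σ , join , ↭-trans typeμ μ↭μ′

merge-⪯ : ∀ {x y ρs} → All (0 <_) (x ∷ y ∷ ρs) → ¬ (x ≡ 1 × y ≡ 1) →
  ((x + y) ∷ ρs) ⪯[ sum (x ∷ y ∷ ρs) ] (x ∷ y ∷ ρs)
merge-⪯ {zero} (() ∷ _) _
merge-⪯ {suc _} {zero} (_ ∷ () ∷ _) _
merge-⪯ {suc zero} {suc zero} _ not-both-1 = ⊥-elim (not-both-1 (refl , refl))
merge-⪯ {suc (suc a)} {suc b} {ρs} (_ ∷ _ ∷ ρs>0) _ = Pivot.pivot-⪯ a b ρs ρs>0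
merge-⪯ {suc zero} {suc (suc b)} {ρs} (_ ∷ _ ∷ ρs>0) _ =
  ⪯-resp-↭ (↭-reflexive (cong (_∷ ρs) (+-comm (2 + b) 1))) (↭-swap _ _ ↭-refl)
    (subst (λ k → ((2 + b + 1) ∷ ρs) ⪯[ k ] ((2 + b) ∷ 1 ∷ ρs)) (sum-↭ (↭-swap (2 + b) 1 (↭-refl {x = ρs})))
      (Pivot.pivot-⪯ b 0 ρs ρs>0))

lemma3p5 : (k : ℕ) → 1 ≤ k → (λs : List ℕ) → IsIntPartition k λs →
    (i j : Fin (length λs)) → i ≢ j → ¬ (lookup λs i ≡ 1 × lookup λs j ≡ 1) →
    (μ : List ℕ) → IsIntPartition k μ →
    μ ↭ ((lookup λs i + lookup λs j) ∷ removeTwo λs i j) →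
    (μ ≺[ k ] λs) ×
    ¬ (Σ (List ℕ) λ ν → IsIntPartition k ν × (μ ≺[ k ] ν) × (ν ≺[ k ] λs))
lemma3p5 k _ λs (λs>0 , λs↘ , Σλs≡k) i j i≢j not-both-1 μ (_ , μ↘ , _) μ↭ = (μ⪯λs , μ≢λs) , no-ν-between
  where
  λs↭ = removeTwo-↭ λs i j i≢j
  μ⪯λs : μ ⪯[ k ] λs
  μ⪯λs = subst (λ k → μ ⪯[ k ] λs) (trans (sym (sum-↭ λs↭)) Σλs≡k)
    (⪯-resp-↭ (↭-sym μ↭) (↭-sym λs↭) (merge-⪯ (All-resp-↭ λs↭ λs>0) not-both-1))
  length-λs≡1+length-μ : length λs ≡ suc (length μ)
  length-λs≡1+length-μ = trans (↭-length λs↭) (cong suc (sym (↭-length μ↭)))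
  μ≢λs : μ ≢ λs
  μ≢λs refl = 1+n≢n (sym length-λs≡1+length-μ)
  no-ν-between : ¬ (Σ (List ℕ) λ ν → IsIntPartition k ν × (μ ≺[ k ] ν) × (ν ≺[ k ] λs))
  no-ν-between (ν , (_ , ν↘ , _) , μ≺ν , ν≺λs) = <⇒≱ (≺⇒length< μ↘ ν↘ μ≺ν)
    (≤-pred (subst (length ν <_) length-λs≡1+length-μ (≺⇒length< ν↘ λs↘ ν≺λs)))
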